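{- Let $s\geq 3$ be an integer and let $\mathcal F\subset\binom{[n]}{s}$ be an intersecting family such that for any pair $u,v\in[n]$ there is a member $F\in\mathcal F$ with $F\cap\{u,v\}=\emptyset$. Then there is a family $\mathcal T\subset\binom{[n]}{3}$ with $|\mathcal T|\leq s^3$ such that every member of $\mathcal F$ contains at least one member of $\mathcal T$.
   Context: $[n]=\{1,2,\dots,n\}$, and $\binom{[n]}{i}$ denotes the family of all $i$-element subsets of $[n]$. A family $\mathcal F$ is intersecting if $A\cap B\neq\emptyset$ for all $A,B\in\mathcal F$. -}

module Defs where

open import Data.Nat using (ℕ)
open import Data.Fin using (Fin)
open import Data.Fin.Subset using (Subset; _∩_; Nonempty; ∣_∣; _⊆_; _∉_)
open import Data.List using (List)
open import Data.List.Membership.Propositional using (_∈_)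
open import Data.Product using (∃; _×_)
open import Relation.Binary.PropositionalEquality using (_≡_)

Uniform : ∀ {n} → ℕ → List (Subset n) → Set
Uniform k 𝓕 = ∀ {F} → F ∈ 𝓕 → ∣ F ∣ ≡ k

Intersecting : ∀ {n} → List (Subset n) → Set
Intersecting 𝓕 = ∀ {A B} → A ∈ 𝓕 → B ∈ 𝓕 → Nonempty (A ∩ B)

AvoidsPairs : ∀ {n} → List (Subset n) → Set
AvoidsPairs {n} 𝓕 = ∀ (u v : Fin n) → ∃ λ F → F ∈ 𝓕 × u ∉ F × v ∉ F

Covers : ∀ {n} → List (Subset n) → List (Subset n) → Set
Covers 𝓣 𝓕 = ∀ {F} → F ∈ 𝓕 → ∃ λ T → T ∈ 𝓣 × T ⊆ F

-- Fix F₀ ∈ 𝓕. A member F meets F₀ in some x; some G_x ∈ 𝓕 avoids x and meets F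
-- in some y ≠ x; some H_xy ∈ 𝓕 avoids x and y and meets F in some z ∉ {x, y}.
-- Thus {x, y, z} ⊆ F, and since G_x and H_xy depend only on x and (x, y), these
-- triples range over at most |F₀| · |G_x| · |H_xy| = s³ sets.
module Submission where

open import Defs
open import Data.Bool using () renaming (_≟_ to _≟ᵇ_)
open import Data.Nat using (ℕ; _≤_; _^_; _*_; suc; z≤n; _≟_)
open import Data.Nat.Properties using (≤-trans; ≤-reflexive; +-mono-≤)
open import Data.Fin using (Fin; zero; suc)
open import Data.Fin.Subset using (Subset; ⁅_⁆; _∪_; _∉_; _⊆_; outside; inside)
  renaming (_∈_ to _∈ₛ_; ∣_∣ to card)
open import Data.Fin.Subset.Properties
  using (x∈p∪q⁻; x∈p∩q⁻; x∈⁅y⁆⇒x≡y; x≢y⇒x∉⁅y⁆; ∣⁅x⁆∣≡1; ∪-identityˡ)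
open import Data.List using (List; []; _∷_; [_]; length; map; concatMap; filter; deduplicate)
open import Data.List.Properties using (length-++; length-map; length-filter; length-deduplicate)
open import Data.List.Membership.Propositional using (_∈_; lose)
open import Data.List.Membership.Propositional.Properties
  using (∈-map⁺; ∈-concatMap⁺; ∈-filter⁺; ∈-filter⁻; ∈-deduplicate⁺; ∈-deduplicate⁻)
open import Data.List.Relation.Unary.Any using (here; there)
open import Data.List.Relation.Unary.Unique.Propositional using (Unique)
import Data.List.Relation.Unary.Unique.DecPropositional.Properties as UniqueDec
open import Data.Product using (∃; _×_; _,_; proj₁; proj₂)
open import Data.Sum using (inj₁; inj₂)
open import Data.Vec using ([]; _∷_; here; there)
open import Data.Vec.Properties using (≡-dec)
open import Relation.Binary.Definitions using (DecidableEquality)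
open import Relation.Binary.PropositionalEquality using (_≡_; _≢_; refl; sym; trans; cong; subst)
open import Relation.Nullary using (contradiction)

elements : ∀ {n} → Subset n → List (Fin n)
elements []            = []
elements (inside  ∷ p) = zero ∷ map suc (elements p)
elements (outside ∷ p) = map suc (elements p)

length-elements : ∀ {n} (p : Subset n) → length (elements p) ≡ card p
length-elements []            = refl
length-elements (inside  ∷ p) = cong suc (trans (length-map suc (elements p)) (length-elements p))
length-elements (outside ∷ p) = trans (length-map suc (elements p)) (length-elements p)

∈⇒∈-elements : ∀ {n} {x : Fin n} {p : Subset n} → x ∈ₛ p → x ∈ elements p
∈⇒∈-elements {p = inside  ∷ p} here        = here refl
∈⇒∈-elements {p = inside  ∷ p} (there x∈p) = there (∈-map⁺ suc (∈⇒∈-elements x∈p))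
∈⇒∈-elements {p = outside ∷ p} (there x∈p) = ∈-map⁺ suc (∈⇒∈-elements x∈p)

∣⁅x⁆∪p∣≡1+∣p∣ : ∀ {n} (x : Fin n) (p : Subset n) → x ∉ p → card (⁅ x ⁆ ∪ p) ≡ suc (card p)
∣⁅x⁆∪p∣≡1+∣p∣ zero    (outside ∷ p) _   = cong (λ q → suc (card q)) (∪-identityˡ p)
∣⁅x⁆∪p∣≡1+∣p∣ zero    (inside  ∷ p) x∉p = contradiction here x∉p
∣⁅x⁆∪p∣≡1+∣p∣ (suc x) (outside ∷ p) x∉p = ∣⁅x⁆∪p∣≡1+∣p∣ x p (λ x∈p → x∉p (there x∈p))
∣⁅x⁆∪p∣≡1+∣p∣ (suc x) (inside  ∷ p) x∉p = cong suc (∣⁅x⁆∪p∣≡1+∣p∣ x p (λ x∈p → x∉p (there x∈p)))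

∈∧∉⇒≢ : ∀ {n} {x y : Fin n} {p : Subset n} → x ∉ p → y ∈ₛ p → x ≢ y
∈∧∉⇒≢ {p = p} x∉p y∈p x≡y = x∉p (subst (_∈ₛ p) (sym x≡y) y∈p)

⁅x⁆⊆p : ∀ {n} {x : Fin n} {p : Subset n} → x ∈ₛ p → ⁅ x ⁆ ⊆ p
⁅x⁆⊆p {x = x} {p} x∈p y∈⁅x⁆ = subst (_∈ₛ p) (sym (x∈⁅y⁆⇒x≡y x y∈⁅x⁆)) x∈p

∪-lub : ∀ {n} {p q r : Subset n} → p ⊆ r → q ⊆ r → p ∪ q ⊆ r
∪-lub {p = p} {q} p⊆r q⊆r x∈p∪q with x∈p∪q⁻ p q x∈p∪q
... | inj₁ x∈p = p⊆r x∈p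
... | inj₂ x∈q = q⊆r x∈q

triple : ∀ {n} → Fin n → Fin n → Fin n → Subset n
triple x y z = ⁅ x ⁆ ∪ (⁅ y ⁆ ∪ ⁅ z ⁆)

∣triple∣≡3 : ∀ {n} {x y z : Fin n} → x ≢ y → x ≢ z → y ≢ z → card (triple x y z) ≡ 3
∣triple∣≡3 {x = x} {y} {z} x≢y x≢z y≢z =
  trans (∣⁅x⁆∪p∣≡1+∣p∣ x (⁅ y ⁆ ∪ ⁅ z ⁆) x∉⁅y⁆∪⁅z⁆)
        (cong suc (trans (∣⁅x⁆∪p∣≡1+∣p∣ y ⁅ z ⁆ (x≢y⇒x∉⁅y⁆ y≢z)) (cong suc (∣⁅x⁆∣≡1 z))))
  where
  x∉⁅y⁆∪⁅z⁆ : x ∉ ⁅ y ⁆ ∪ ⁅ z ⁆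
  x∉⁅y⁆∪⁅z⁆ x∈ with x∈p∪q⁻ ⁅ y ⁆ ⁅ z ⁆ x∈
  ... | inj₁ x∈⁅y⁆ = x≢y (x∈⁅y⁆⇒x≡y y x∈⁅y⁆)
  ... | inj₂ x∈⁅z⁆ = x≢z (x∈⁅y⁆⇒x≡y z x∈⁅z⁆)

triple⊆ : ∀ {n} {x y z : Fin n} {p : Subset n} → x ∈ₛ p → y ∈ₛ p → z ∈ₛ p → triple x y z ⊆ p
triple⊆ x∈p y∈p z∈p = ∪-lub (⁅x⁆⊆p x∈p) (∪-lub (⁅x⁆⊆p y∈p) (⁅x⁆⊆p z∈p))

length-concatMap-≤ : ∀ {A B : Set} (f : A → List B) {m : ℕ} →
  (∀ x → length (f x) ≤ m) → ∀ xs → length (concatMap f xs) ≤ length xs * m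
length-concatMap-≤ f bound []       = z≤n
length-concatMap-≤ f bound (x ∷ xs) =
  ≤-trans (≤-reflexive (length-++ (f x))) (+-mono-≤ (bound x) (length-concatMap-≤ f bound xs))

∈-concatMap⁺′ : ∀ {A B : Set} {f : A → List B} {xs : List A} {x : A} {y : B} →
  x ∈ xs → y ∈ f x → y ∈ concatMap f xs
∈-concatMap⁺′ {f = f} x∈xs y∈fx = ∈-concatMap⁺ f (lose x∈xs y∈fx)

_≟ₛ_ : ∀ {n} → DecidableEquality (Subset n)
_≟ₛ_ = ≡-dec _≟ᵇ_

module _ {n : ℕ} (𝓛 : List (Subset n)) where

  private
    𝓛₃ : List (Subset n)
    𝓛₃ = filter (λ T → card T ≟ 3) 𝓛

  threeSets : List (Subset n)
  threeSets = deduplicate _≟ₛ_ 𝓛₃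

  threeSets-unique : Unique threeSets
  threeSets-unique = UniqueDec.deduplicate-! _≟ₛ_ 𝓛₃

  threeSets-uniform : Uniform 3 threeSets
  threeSets-uniform T∈ = proj₂ (∈-filter⁻ (λ T → card T ≟ 3) {xs = 𝓛} (∈-deduplicate⁻ _≟ₛ_ 𝓛₃ T∈))

  length-threeSets : length threeSets ≤ length 𝓛
  length-threeSets = ≤-trans (length-deduplicate _≟ₛ_ 𝓛₃) (length-filter (λ T → card T ≟ 3) 𝓛)

  ∈-threeSets⁺ : ∀ {T} → T ∈ 𝓛 → card T ≡ 3 → T ∈ threeSets
  ∈-threeSets⁺ T∈𝓛 ∣T∣≡3 = ∈-deduplicate⁺ _≟ₛ_ (∈-filter⁺ (λ T → card T ≟ 3) T∈𝓛 ∣T∣≡3)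

module Candidates {n : ℕ} {𝓕 : List (Subset n)} (avoid : AvoidsPairs 𝓕) where

  avoider : Fin n → Fin n → Subset n
  avoider u v = proj₁ (avoid u v)

  candidates : Subset n → List (Subset n)
  candidates F₀ =
    concatMap (λ x → concatMap (λ y → concatMap (λ z → [ triple x y z ])
                                                (elements (avoider x y)))
                               (elements (avoider x x)))
              (elements F₀)

  length-candidates : ∀ {s F₀} → Uniform s 𝓕 → F₀ ∈ 𝓕 → length (candidates F₀) ≤ s ^ 3
  length-candidates {s} uniform F₀∈𝓕 =
    concatMap-≤ F₀∈𝓕 λ x →
      concatMap-≤ (member x x) λ y →
        concatMap-≤ (member x y) λ _ → ≤-reflexive refl
    where
    member : ∀ u v → avoider u v ∈ 𝓕
    member u v = proj₁ (proj₂ (avoid u v))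

    concatMap-≤ : ∀ {B : Set} {F m} {f : Fin n → List B} → F ∈ 𝓕 →
      (∀ x → length (f x) ≤ m) → length (concatMap f (elements F)) ≤ s * m
    concatMap-≤ {F = F} {m} {f} F∈𝓕 bound =
      ≤-trans (length-concatMap-≤ f bound (elements F))
              (≤-reflexive (cong (_* m) (trans (length-elements F) (uniform F∈𝓕))))

  triple-in-candidates : ∀ {F₀ F} → Intersecting 𝓕 → F₀ ∈ 𝓕 → F ∈ 𝓕 →
    ∃ λ T → T ∈ candidates F₀ × card T ≡ 3 × T ⊆ F
  triple-in-candidates {F₀} {F} intersecting F₀∈𝓕 F∈𝓕
    with x , x∈F₀∩F ← intersecting F₀∈𝓕 F∈𝓕
    with G∈𝓕 , x∉G , _ ← proj₂ (avoid x x)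
    with y , y∈G∩F ← intersecting G∈𝓕 F∈𝓕
    with H∈𝓕 , x∉H , y∉H ← proj₂ (avoid x y)
    with z , z∈H∩F ← intersecting H∈𝓕 F∈𝓕
    with x∈F₀ , x∈F ← x∈p∩q⁻ F₀ F x∈F₀∩F
    with y∈G , y∈F ← x∈p∩q⁻ (avoider x x) F y∈G∩F
    with z∈H , z∈F ← x∈p∩q⁻ (avoider x y) F z∈H∩F
    = triple x y z
    , ∈-concatMap⁺′ (∈⇒∈-elements x∈F₀)
        (∈-concatMap⁺′ (∈⇒∈-elements y∈G) (∈-concatMap⁺′ (∈⇒∈-elements z∈H) (here refl)))
    , ∣triple∣≡3 (∈∧∉⇒≢ x∉G y∈G) (∈∧∉⇒≢ x∉H z∈H) (∈∧∉⇒≢ y∉H z∈H)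
    , triple⊆ x∈F y∈F z∈F

-- The construction never uses 3 ≤ s.
lemma2p1 : (n s : ℕ) → 3 ≤ s → (𝓕 : List (Subset n)) →
    Uniform s 𝓕 → Intersecting 𝓕 → AvoidsPairs 𝓕 →
    ∃ λ (𝓣 : List (Subset n)) → Unique 𝓣 × Uniform 3 𝓣 × length 𝓣 ≤ s ^ 3 × Covers 𝓣 𝓕
lemma2p1 n s _ [] _ _ _ = [] , threeSets-unique [] , threeSets-uniform [] , z≤n , λ ()
lemma2p1 n s _ 𝓕@(F₀ ∷ _) uniform intersecting avoid =
  threeSets 𝓒 , threeSets-unique 𝓒 , threeSets-uniform 𝓒 ,
  ≤-trans (length-threeSets 𝓒) (length-candidates uniform (here refl)) , covers
  where
  open Candidates avoid

  𝓒 : List (Subset n)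
  𝓒 = candidates F₀

  covers : Covers (threeSets 𝓒) 𝓕
  covers F∈𝓕 with T , T∈𝓒 , ∣T∣≡3 , T⊆F ← triple-in-candidates intersecting (here refl) F∈𝓕
    = T , ∈-threeSets⁺ 𝓒 T∈𝓒 ∣T∣≡3 , T⊆F
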